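{- Let $*:X^{m} \rightarrow X$ be a $k$-associative $m$-ary operation on a set $X$ where $m\geq 2$ and $k \geq 1$ are integers. Let $p(x_1*\dots*x_n)$ and $p^{\prime}(x_1 * \dots *x_n)$ be two $m$-ary parenthesizations of the $m$-ary expression $x_1*\dots*x_n$, where $n = m+g(m-1)$ for some positive integer $g$. Then $p(x_1*\dots*x_n)$ is $k$-equivalent to $p^{\prime}(x_1 * \dots *x_n)$ if and only if $$p(u_1 \circ \dots \circ u_n)= p^{\prime}(u_1 \circ \dots \circ u_n),$$ where the equality comes from evaluating the parenthesizations under $\circ$ in the algebra $A$.
   Context: An $m$-ary operation $*:X^m\to X$ is left-associative: for $g\ge 1$, $x_1*\dots*x_{m+g(m-1)}$ means $((\dots((x_1*\dots*x_m)*x_{m+1}*\dots*x_{m+(m-1)})\dots)*\dots*x_{m+g(m-1)})$, i.e. evaluated from left to right. It is $k$-associative if for $1\le j\le m-1$, $x_1*\dots*x_{j-1}*(x_j*\dots*x_{j+k(m-1)})*x_{j+k(m-1)+1}*\dots*x_{m+k(m-1)} = x_1*\dots*x_{j}*(x_{j+1}*\dots*x_{j+k(m-1)+1})*x_{j+k(m-1)+2}*\dots*x_{m+k(m-1)}$ for all elements. For parenthesizations $p,p'$ of $x_1*\dots*x_n$, write $p\preceq_k p'$ if $p'$ is obtained from $p$ by finitely many left-hand-side to right-hand-side applications of this $k$-associative identity; this is a partial order (the $k$-associative order), its connected components are the $k$-components, and two parenthesizations are $k$-equivalent if they lie in the same $k$-component. Let $A=\mathbb{C}\langle u_1,\dots,u_n\rangle$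 be the free associative algebra over $\mathbb{C}$ in $n$ indeterminates $u_1,\dots,u_n$, and let $\omega\in A$ be an element of order $k(m-1)$ (e.g. $\omega=e^{2\pi i/(k(m-1))}$). Define the (left-associative) $m$-ary operation $\circ:A^m\to A$ by $a_1\circ\dots\circ a_m=\omega^{m-1}a_1+\omega^{m-2}a_2+\dots+\omega a_{m-1}+a_m$; this operation is $k$-associative. $p(u_1\circ\dots\circ u_n)$ denotes evaluating the parenthesization $p$ with $x_i$ replaced by $u_i$ and $*$ by $\circ$. -}

module Defs where

open import Level using (Level)
open import Data.Nat using (ℕ; zero; suc; _∸_; _<_; _≟_)
import Data.Nat as ℕ
open import Data.Fin using (Fin; toℕ)
open import Data.Vec using (Vec; []; _∷_; lookup; toList; _[_]≔_)
open import Data.List using (List; []; _∷_; _++_; length)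
open import Relation.Nullary using (¬_; yes; no)
open import Relation.Binary.PropositionalEquality using (_≡_)
open import Relation.Binary.Construct.Closure.Equivalence using (EqClosure)
open import Relation.Binary.Construct.Closure.ReflexiveTransitive using (Star)
open import Algebra.Bundles using (CommutativeRing)

-- m-ary parenthesizations (full m-ary bracketings) as m-ary trees.
-- The leaves, read from left to right, are the variables x₁, x₂, … .

data Tree (m : ℕ) : Set where
  leaf : Tree m
  node : Vec (Tree m) m → Tree m

mutual
  leaves : ∀ {m} → Tree m → ℕ
  leaves leaf     = 1
  leaves (node v) = leavesV v

  leavesV : ∀ {m j} → Vec (Tree m) j → ℕ
  leavesV []       = 0
  leavesV (t ∷ ts) = leaves t ℕ.+ leavesV ts

-- Left-associated expressions.
-- LeftComb g t xs : t is the left-associated expression  y₁ * … * y_{m+(g-1)(m-1)}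
-- with g ≥ 1 operations, where xs = y₁, y₂, … are arbitrary subterms.

data LeftComb {m : ℕ} : ℕ → Tree m → List (Tree m) → Set where
  comb-one : (v : Vec (Tree m) m) → LeftComb 1 (node v) (toList v)
  comb-suc : ∀ {g t xs} → LeftComb g t xs →
             (v : Vec (Tree m) m) (ys : List (Tree m)) →
             toList v ≡ t ∷ ys →
             LeftComb (suc g) (node v) (xs ++ ys)

-- One application (left-hand side → right-hand side) of the
-- k-associative identity, at the root (with x_i replaced by arbitrary
-- subterms) or inside a subterm.
--
-- At the root, with  j = length pre + 1  (so 1 ≤ j ≤ m-1):
--   LHS children:  pre , (mid as left-assoc. expression with k ops) , post
--   RHS children:  pre , a , (mid' as left-assoc. expression with k ops) , post'
--   where  mid ++ post = a ∷ (mid' ++ post')  (same sequence of x's).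

data KStep (m k : ℕ) : Tree m → Tree m → Set where
  k-assoc : (pre mid post mid' post' : List (Tree m)) (a c c' : Tree m)
            (v v' : Vec (Tree m) m) →
            suc (length pre) < m →
            LeftComb k c mid → LeftComb k c' mid' →
            mid ++ post ≡ a ∷ (mid' ++ post') →
            toList v  ≡ pre ++ (c ∷ post) →
            toList v' ≡ pre ++ (a ∷ c' ∷ post') →
            KStep m k (node v) (node v')
  inside  : (v : Vec (Tree m) m) (i : Fin m) {t' : Tree m} →
            KStep m k (lookup v i) t' →
            KStep m k (node v) (node (v [ i ]≔ t'))

_⪯[_]_ : ∀ {m} → Tree m → ℕ → Tree m → Set
p ⪯[ k ] p' = Star (KStep _ k) p p'

KEquivalent : ∀ {m} → ℕ → Tree m → Tree m → Set
KEquivalent {m} k = EqClosure (KStep m k)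

-- Evaluating a parenthesization p(y₁ * … * yₙ) for an m-ary operation
-- op and leaf values y : ℕ → X  (leaf number i, from 0, gets y i).

module Evaluate {a} {X : Set a} {m : ℕ} (op : Vec X m → X) (y : ℕ → X) where
  mutual
    evalAt : Tree m → ℕ → X
    evalAt leaf     i = y i
    evalAt (node v) i = op (evalsAt v i)

    evalsAt : ∀ {j} → Vec (Tree m) j → ℕ → Vec X j
    evalsAt []       i = []
    evalsAt (t ∷ ts) i = evalAt t i ∷ evalsAt ts (i ℕ.+ leaves t)

  eval : Tree m → X
  eval t = evalAt t 0

-- An element is given by its coefficient on each word in u₁,…,uₙ
-- (words = List (Fin n)); equality is coefficientwise.  The free
-- associative algebra R⟨u₁,…,uₙ⟩ is the subset of finitely supported
-- elements; all elements occurring below lie in it.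

module FreeAlg {c ℓ} (R : CommutativeRing c ℓ) (n : ℕ) where
  open CommutativeRing R

  A : Set c
  A = List (Fin n) → Carrier

  _≈A_ : A → A → Set ℓ
  f ≈A g = ∀ w → f w ≈ g w

  -- the indeterminate u_{i+1}  (i counted from 0)
  u : ℕ → A
  u i (j ∷ []) with toℕ j ≟ i
  ... | yes _ = 1#
  ... | no  _ = 0#
  u i _ = 0#

  pow : Carrier → ℕ → Carrier
  pow x zero    = 1#
  pow x (suc e) = x * pow x e

  HasOrder : Carrier → ℕ → Set ℓ
  HasOrder ω N = pow ω N ≈ 1# × (∀ j → 0 < j → j < N → ¬ (pow ω j ≈ 1#))
    where open import Data.Product using (_×_)

  sumV : ∀ {j} → Vec Carrier j → Carrier
  sumV []       = 0#
  sumV (x ∷ xs) = x + sumV xs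

  circ : (ω : Carrier) (m : ℕ) → Vec A m → A
  circ ω m as w = sumV (Data.Vec.tabulate (λ (i : Fin m) → pow ω (m ∸ 1 ∸ toℕ i) * lookup as i w))
    where import Data.Vec

  evalCirc : (ω : Carrier) (m : ℕ) → Tree m → A
  evalCirc ω m = Evaluate.eval (circ ω m) u

-- Evaluating p under ∘ gives Σᵢ ω^eᵢ uᵢ, where the exponent eᵢ of leaf i adds up, over the
-- nodes above leaf i, the number of siblings to the right of the branch leading to i.  As the uᵢ
-- are linearly independent and ω has order N = k(m−1), two evaluations agree exactly when the
-- exponent sequences agree modulo N.  A k-associative step adds N to a nonempty block of
-- exponents, so k-equivalent parenthesizations evaluate equally.  Conversely, let sᵢ count the
-- nodes whose leftmost leaf lies to the right of leaf i; then eᵢ + (m−1)sᵢ = n−1−i.  Undoing a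
-- step strictly decreases Σᵢ sᵢ, so every parenthesization is k-equivalent to one in which no
-- leaf but the first is the leftmost leaf of k or more nodes; such a parenthesization is
-- determined by the sᵢ modulo k, and the identity reads these off from the eᵢ modulo N.

module Submission where

open import Defs

module Combinatorics where

  open import Data.Nat using (ℕ; zero; suc; _+_; _*_; _∸_; _≤_; _<_; z≤n; s≤s; NonZero; >-nonZero⁻¹)
  open import Data.Nat.Properties
  open import Data.Nat.DivMod
  open import Data.Nat.Divisibility using (divides)
  open import Data.Nat.Induction using (<-wellFounded)
  open import Data.Nat.ListAction using (sum)
  open import Data.Nat.ListAction.Properties using (sum-++)
  open import Data.Nat.Tactic.RingSolver using (solve-∀)
  open import Algebra.Properties.CommutativeSemigroup +-commutativeSemigroup using (x∙yz≈y∙xz; interchange)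
  open import Data.Fin using (zero; suc)
  open import Data.Vec using (Vec; []; _∷_; lookup; toList; _[_]≔_; init; last; initLast)
  import Data.Vec.Properties as Vec
  import Data.Vec.Relation.Unary.All as VecAll
  open import Data.List using (List; []; _∷_; _++_; length; map; zipWith; downFrom)
  open import Data.List.Properties using (∷-injectiveˡ; ∷-injectiveʳ; map-++; length-++; ++-assoc; length-map; map-∘; map-cong)
  open import Data.List.Relation.Unary.All using (All; []; _∷_)
  open import Data.List.Relation.Unary.All.Properties using (++⁺)
  open import Data.Product using (∃-syntax; _×_; _,_; proj₁; proj₂)
  open import Data.Sum using (_⊎_; inj₁; inj₂)
  open import Relation.Nullary using (yes; no)
  open import Relation.Binary.PropositionalEquality
  open import Induction.WellFounded using (Acc; acc)
  open import Function.Bundles using (_⇔_; mk⇔)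
  import Relation.Binary.Construct.Closure.Equivalence as EqClosure
  open import Relation.Binary.Construct.Closure.ReflexiveTransitive using (ε; _◅_)
  open import Relation.Binary.Construct.Closure.Symmetric using (bwd)

  -- n ∸ a % n is an additive inverse of a modulo n.
  %-cancel-+ˡ : ∀ {n} .{{_ : NonZero n}} a b x y →
                a % n ≡ b % n → (a + x) % n ≡ (b + y) % n → x % n ≡ y % n
  %-cancel-+ˡ {n} a b x y a≡b eq = begin
    x % n                                   ≡⟨ complement a x ⟨
    (n ∸ a % n + (a + x)) % n               ≡⟨ %-distribˡ-+ (n ∸ a % n) (a + x) n ⟩
    ((n ∸ a % n) % n + (a + x) % n) % n     ≡⟨ cong₂ (λ r s → ((n ∸ r) % n + s) % n) a≡b eq ⟩
    ((n ∸ b % n) % n + (b + y) % n) % n     ≡⟨ %-distribˡ-+ (n ∸ b % n) (b + y) n ⟨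
    (n ∸ b % n + (b + y)) % n               ≡⟨ complement b y ⟩
    y % n                                   ∎
    where
    open ≡-Reasoning
    complement : ∀ c z → (n ∸ c % n + (c + z)) % n ≡ z % n
    complement c z = trans (cong (_% n) (sym (+-assoc (n ∸ c % n) c z))) (%-remove-+ˡ z (divides (suc (c / n)) (begin
      n ∸ c % n + c                   ≡⟨ cong (n ∸ c % n +_) (m≡m%n+[m/n]*n c n) ⟩
      n ∸ c % n + (c % n + c / n * n) ≡⟨ +-assoc (n ∸ c % n) (c % n) (c / n * n) ⟨
      n ∸ c % n + c % n + c / n * n   ≡⟨ cong (_+ c / n * n) (m∸n+n≡m (m%n≤n c n)) ⟩
      n + c / n * n                   ∎)))

  %-*-cancelʳ : ∀ s t k d .{{_ : NonZero k}} .{{_ : NonZero d}} .{{_ : NonZero (k * d)}} →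
                s * d % (k * d) ≡ t * d % (k * d) → s % k ≡ t % k
  %-*-cancelʳ s t k d eq = *-cancelʳ-≡ (s % k) (t % k) d
    (trans (m%n*o≡m*o%[n*o] s k d) (trans eq (sym (m%n*o≡m*o%[n*o] t k d))))

  map-+-+ : ∀ a b (l : List ℕ) → map (a +_) (map (b +_) l) ≡ map ((a + b) +_) l
  map-+-+ a b l = trans (sym (map-∘ l)) (map-cong (λ x → sym (+-assoc a b x)) l)

  suffixSums : List ℕ → List ℕ
  suffixSums []       = []
  suffixSums (x ∷ xs) = sum xs ∷ suffixSums xs

  length-suffixSums : ∀ xs → length (suffixSums xs) ≡ length xs
  length-suffixSums []       = refl
  length-suffixSums (x ∷ xs) = cong suc (length-suffixSums xs)

  suffixSums-++ : ∀ xs ys → suffixSums (xs ++ ys) ≡ map (_+ sum ys) (suffixSums xs) ++ suffixSums ys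
  suffixSums-++ []       ys = refl
  suffixSums-++ (x ∷ xs) ys = cong₂ _∷_ (sum-++ xs ys) (suffixSums-++ xs ys)

  sum-zipWith-+ : ∀ xs ys → length xs ≡ length ys → sum (zipWith _+_ xs ys) ≡ sum xs + sum ys
  sum-zipWith-+ []       []       _ = refl
  sum-zipWith-+ (x ∷ xs) (y ∷ ys) eq = trans (cong (x + y +_) (sum-zipWith-+ xs ys (suc-injective eq)))
                                             (interchange x y (sum xs) (sum ys))

  sum-map-* : ∀ d xs → sum (map (d *_) xs) ≡ d * sum xs
  sum-map-* d []       = sym (*-zeroʳ d)
  sum-map-* d (x ∷ xs) = trans (cong (d * x +_) (sum-map-* d xs)) (sym (*-distribˡ-+ d x (sum xs)))

  zipWith-++ : ∀ {A : Set} (f : A → A → A) xs ys us vs → length xs ≡ length us →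
               zipWith f (xs ++ ys) (us ++ vs) ≡ zipWith f xs us ++ zipWith f ys vs
  zipWith-++ f []       ys []       vs _  = refl
  zipWith-++ f (x ∷ xs) ys (u ∷ us) vs eq = cong (f x u ∷_) (zipWith-++ f xs ys us vs (suc-injective eq))

  zipWith-+-map-+ : ∀ a b xs ys → zipWith _+_ (map (a +_) xs) (map (b +_) ys) ≡ map ((a + b) +_) (zipWith _+_ xs ys)
  zipWith-+-map-+ a b []       ys       = refl
  zipWith-+-map-+ a b (x ∷ xs) []       = refl
  zipWith-+-map-+ a b (x ∷ xs) (y ∷ ys) = cong₂ _∷_ (interchange a x b y) (zipWith-+-map-+ a b xs ys)

  downFrom-+ : ∀ a b → downFrom (a + b) ≡ map (b +_) (downFrom a) ++ downFrom b
  downFrom-+ zero    b = refl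
  downFrom-+ (suc a) b = cong₂ _∷_ (+-comm a b) (downFrom-+ a b)

  toList-init-last : ∀ {A : Set} {j} (v : Vec A (suc j)) → toList v ≡ toList (init v) ++ last v ∷ []
  toList-init-last v = trans (cong toList (proj₂ (proj₂ (initLast v)))) (Vec.toList-∷ʳ (last v) (init v))

  RaisedBlock : ℕ → List ℕ → List ℕ → Set
  RaisedBlock N l r = ∃[ xs ] ∃[ as ] ∃[ ys ]
    (l ≡ xs ++ map (N +_) as ++ ys) × (r ≡ xs ++ as ++ ys) × (0 < length as)

  module _ {N : ℕ} where

    raised-++ˡ : ∀ zs {l r} → RaisedBlock N l r → RaisedBlock N (zs ++ l) (zs ++ r)
    raised-++ˡ zs (xs , as , ys , refl , refl , as≢[]) =
      zs ++ xs , as , ys , sym (++-assoc zs xs _) , sym (++-assoc zs xs _) , as≢[]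

    raised-++ʳ : ∀ zs {l r} → RaisedBlock N l r → RaisedBlock N (l ++ zs) (r ++ zs)
    raised-++ʳ zs (xs , as , ys , refl , refl , as≢[]) =
      xs , as , ys ++ zs ,
      trans (++-assoc xs _ zs) (cong (xs ++_) (++-assoc (map (N +_) as) ys zs)) ,
      trans (++-assoc xs _ zs) (cong (xs ++_) (++-assoc as ys zs)) , as≢[]

    raised-map-+ : ∀ j {l r} → RaisedBlock N l r → RaisedBlock N (map (j +_) l) (map (j +_) r)
    raised-map-+ j (xs , as , ys , refl , refl , as≢[]) =
      map (j +_) xs , map (j +_) as , map (j +_) ys ,
      trans (map-++ (j +_) xs _) (cong (map (j +_) xs ++_)
        (trans (map-++ (j +_) (map (N +_) as) ys) (cong (_++ map (j +_) ys) commute))) ,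
      trans (map-++ (j +_) xs _) (cong (map (j +_) xs ++_) (map-++ (j +_) as ys)) ,
      subst (0 <_) (sym (length-map (j +_) as)) as≢[]
      where
      commute : map (j +_) (map (N +_) as) ≡ map (N +_) (map (j +_) as)
      commute = trans (sym (map-∘ as)) (trans (map-cong (x∙yz≈y∙xz j N) as) (map-∘ as))

    module _ .{{_ : NonZero N}} where

      raised-residues : ∀ {l r} → RaisedBlock N l r → map (_% N) l ≡ map (_% N) r
      raised-residues (xs , as , ys , refl , refl , _) = begin
        map (_% N) (xs ++ map (N +_) as ++ ys)
          ≡⟨ trans (map-++ (_% N) xs _) (cong (map (_% N) xs ++_) (map-++ (_% N) (map (N +_) as) ys)) ⟩
        map (_% N) xs ++ map (_% N) (map (N +_) as) ++ map (_% N) ys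
          ≡⟨ cong (λ bs → map (_% N) xs ++ bs ++ map (_% N) ys) drop-N ⟩
        map (_% N) xs ++ map (_% N) as ++ map (_% N) ys
          ≡⟨ trans (map-++ (_% N) xs _) (cong (map (_% N) xs ++_) (map-++ (_% N) as ys)) ⟨
        map (_% N) (xs ++ as ++ ys) ∎
        where
        open ≡-Reasoning
        drop-N : map (_% N) (map (N +_) as) ≡ map (_% N) as
        drop-N = trans (sym (map-∘ as)) (map-cong (λ a → trans (cong (_% N) (+-comm N a)) ([m+n]%n≡m%n a N)) as)

      raised-sum : ∀ {l r} → RaisedBlock N l r → sum r < sum l
      raised-sum (xs , a ∷ as , ys , refl , refl , _) = begin-strict
        sum (xs ++ (a ∷ as) ++ ys)                  ≡⟨ sum-++ xs _ ⟩
        sum xs + sum ((a ∷ as) ++ ys)               ≡⟨ cong (sum xs +_) (sum-++ (a ∷ as) ys) ⟩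
        sum xs + (sum (a ∷ as) + sum ys)            <⟨ +-monoʳ-< (sum xs) (+-monoˡ-< (sum ys)
                                                         (+-mono-<-≤ (m<n+m a (>-nonZero⁻¹ N)) (sum-≤ as))) ⟩
        sum xs + (sum (map (N +_) (a ∷ as)) + sum ys) ≡⟨ cong (sum xs +_) (sum-++ (map (N +_) (a ∷ as)) ys) ⟨
        sum xs + sum (map (N +_) (a ∷ as) ++ ys)    ≡⟨ sum-++ xs _ ⟨
        sum (xs ++ map (N +_) (a ∷ as) ++ ys)       ∎
        where
        open ≤-Reasoning
        sum-≤ : ∀ as → sum as ≤ sum (map (N +_) as)
        sum-≤ []       = z≤n
        sum-≤ (a ∷ as) = +-mono-≤ (m≤n+m a N) (sum-≤ as)

  module _ {m : ℕ} where

    mutual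
      exponents : Tree m → List ℕ
      exponents leaf     = 0 ∷ []
      exponents (node v) = exponentsᵛ v

      exponentsᵛ : ∀ {j} → Vec (Tree m) j → List ℕ
      exponentsᵛ []             = []
      exponentsᵛ {suc j} (t ∷ ts) = map (j +_) (exponents t) ++ exponentsᵛ ts

    exponentsˡ : List (Tree m) → List ℕ
    exponentsˡ []       = []
    exponentsˡ (t ∷ ts) = map (length ts +_) (exponents t) ++ exponentsˡ ts

    exponentsᵛ≡exponentsˡ : ∀ {j} (v : Vec (Tree m) j) → exponentsᵛ v ≡ exponentsˡ (toList v)
    exponentsᵛ≡exponentsˡ []                 = refl
    exponentsᵛ≡exponentsˡ {suc j} (t ∷ ts) rewrite Vec.length-toList ts =
      cong (map (j +_) (exponents t) ++_) (exponentsᵛ≡exponentsˡ ts)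

    exponentsˡ-++ : ∀ xs ys → exponentsˡ (xs ++ ys) ≡ map (length ys +_) (exponentsˡ xs) ++ exponentsˡ ys
    exponentsˡ-++ []       ys = refl
    exponentsˡ-++ (x ∷ xs) ys = begin
      map (length (xs ++ ys) +_) (exponents x) ++ exponentsˡ (xs ++ ys)
        ≡⟨ cong₂ _++_ shift (exponentsˡ-++ xs ys) ⟩
      map (length ys +_) (map (length xs +_) (exponents x)) ++ map (length ys +_) (exponentsˡ xs) ++ exponentsˡ ys
        ≡⟨ ++-assoc (map (length ys +_) (map (length xs +_) (exponents x))) _ _ ⟨
      (map (length ys +_) (map (length xs +_) (exponents x)) ++ map (length ys +_) (exponentsˡ xs)) ++ exponentsˡ ys
        ≡⟨ cong (_++ exponentsˡ ys) (map-++ (length ys +_) (map (length xs +_) (exponents x)) (exponentsˡ xs)) ⟨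
      map (length ys +_) (exponentsˡ (x ∷ xs)) ++ exponentsˡ ys ∎
      where
      open ≡-Reasoning
      shift : map (length (xs ++ ys) +_) (exponents x) ≡ map (length ys +_) (map (length xs +_) (exponents x))
      shift = trans (cong (λ a → map (a +_) (exponents x)) (trans (length-++ xs) (+-comm (length xs) (length ys))))
                    (sym (map-+-+ (length ys) (length xs) (exponents x)))

    raised-exponentsˡ-++ˡ : ∀ {N} pre {xs ys} → length xs ≡ length ys →
      RaisedBlock N (exponentsˡ xs) (exponentsˡ ys) → RaisedBlock N (exponentsˡ (pre ++ xs)) (exponentsˡ (pre ++ ys))
    raised-exponentsˡ-++ˡ pre {xs} {ys} |xs|≡|ys| r
      rewrite exponentsˡ-++ pre xs | exponentsˡ-++ pre ys | |xs|≡|ys| = raised-++ˡ _ r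

    mutual
      length-exponents : ∀ t → length (exponents t) ≡ leaves t
      length-exponents leaf     = refl
      length-exponents (node v) = length-exponentsᵛ v

      length-exponentsᵛ : ∀ {j} (v : Vec (Tree m) j) → length (exponentsᵛ v) ≡ leavesV v
      length-exponentsᵛ []             = refl
      length-exponentsᵛ {suc j} (t ∷ ts) = trans (length-++ (map (j +_) (exponents t)))
        (cong₂ _+_ (trans (length-map (j +_) (exponents t)) (length-exponents t)) (length-exponentsᵛ ts))

    leftComb-exponents : ∀ {g c xs} → LeftComb g c xs → exponents c ≡ exponentsˡ xs
    leftComb-exponents (comb-one v) = exponentsᵛ≡exponentsˡ v
    leftComb-exponents (comb-suc {t = t} {xs} c v ys eq) = begin
      exponentsᵛ v                                      ≡⟨ exponentsᵛ≡exponentsˡ v ⟩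
      exponentsˡ (toList v)                             ≡⟨ cong exponentsˡ eq ⟩
      map (length ys +_) (exponents t) ++ exponentsˡ ys ≡⟨ cong (λ e → map (length ys +_) e ++ exponentsˡ ys) (leftComb-exponents c) ⟩
      map (length ys +_) (exponentsˡ xs) ++ exponentsˡ ys ≡⟨ exponentsˡ-++ xs ys ⟨
      exponentsˡ (xs ++ ys)                             ∎
      where open ≡-Reasoning

  module _ {d : ℕ} where

    leaves-positive : ∀ (t : Tree (suc d)) → 0 < leaves t
    leaves-positive leaf            = s≤s z≤n
    leaves-positive (node (t ∷ ts)) = ≤-trans (leaves-positive t) (m≤m+n (leaves t) _)

    exponents-nonempty : ∀ (t : Tree (suc d)) → 0 < length (exponents t)
    exponents-nonempty t = subst (0 <_) (sym (length-exponents t)) (leaves-positive t)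

    leftComb-length : ∀ {g c xs} → LeftComb {suc d} g c xs → length xs ≡ suc (g * d)
    leftComb-length (comb-one v) = trans (Vec.length-toList v) (cong suc (sym (+-identityʳ d)))
    leftComb-length (comb-suc {g = g} {xs = xs} c v ys eq) = begin
      length (xs ++ ys)     ≡⟨ length-++ xs ⟩
      length xs + length ys ≡⟨ cong₂ _+_ (leftComb-length c) length-ys ⟩
      suc (g * d) + d       ≡⟨ cong suc (+-comm (g * d) d) ⟩
      suc (d + g * d)       ∎
      where
      open ≡-Reasoning
      length-ys : length ys ≡ d
      length-ys = suc-injective (trans (sym (cong length eq)) (Vec.length-toList v))

    module _ {k : ℕ} where

      root-raises : ∀ {mid post mid' post' a c c'} →
        LeftComb k c mid → LeftComb k c' mid' → mid ++ post ≡ a ∷ (mid' ++ post') →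
        RaisedBlock (k * d) (exponentsˡ (c ∷ post)) (exponentsˡ (a ∷ c' ∷ post'))
      root-raises {mid} {post} {mid'} {post'} {a} {c} {c'} lc lc' mid≡ =
        [] , map (suc (length post') +_) (exponents a) , exponentsˡ (mid' ++ post') ,
        lhs , rhs , subst (0 <_) (sym (length-map _ (exponents a))) (exponents-nonempty a)
        where
        open ≡-Reasoning
        length-rest : length (mid' ++ post') ≡ k * d + suc (length post')
        length-rest = trans (length-++ mid') (trans (cong (_+ length post') (leftComb-length lc'))
                                                     (sym (+-suc (k * d) (length post'))))
        lhs : exponentsˡ (c ∷ post) ≡ map (k * d +_) (map (suc (length post') +_) (exponents a)) ++ exponentsˡ (mid' ++ post')
        lhs = begin
          map (length post +_) (exponents c) ++ exponentsˡ post
            ≡⟨ cong (λ e → map (length post +_) e ++ exponentsˡ post) (leftComb-exponents lc) ⟩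
          map (length post +_) (exponentsˡ mid) ++ exponentsˡ post
            ≡⟨ exponentsˡ-++ mid post ⟨
          exponentsˡ (mid ++ post)
            ≡⟨ cong exponentsˡ mid≡ ⟩
          map (length (mid' ++ post') +_) (exponents a) ++ exponentsˡ (mid' ++ post')
            ≡⟨ cong (λ j → map (j +_) (exponents a) ++ exponentsˡ (mid' ++ post')) length-rest ⟩
          map ((k * d + suc (length post')) +_) (exponents a) ++ exponentsˡ (mid' ++ post')
            ≡⟨ cong (_++ exponentsˡ (mid' ++ post')) (map-+-+ (k * d) _ (exponents a)) ⟨
          map (k * d +_) (map (suc (length post') +_) (exponents a)) ++ exponentsˡ (mid' ++ post') ∎
        rhs : exponentsˡ (a ∷ c' ∷ post') ≡ map (suc (length post') +_) (exponents a) ++ exponentsˡ (mid' ++ post')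
        rhs = cong (map (suc (length post') +_) (exponents a) ++_) (begin
          map (length post' +_) (exponents c') ++ exponentsˡ post'
            ≡⟨ cong (λ e → map (length post' +_) e ++ exponentsˡ post') (leftComb-exponents lc') ⟩
          map (length post' +_) (exponentsˡ mid') ++ exponentsˡ post'
            ≡⟨ exponentsˡ-++ mid' post' ⟨
          exponentsˡ (mid' ++ post') ∎)

      step-raises : ∀ {l r} → KStep (suc d) k l r → RaisedBlock (k * d) (exponents l) (exponents r)
      step-raises (k-assoc pre mid post mid' post' a c c' v v' _ lc lc' mid≡ v≡ v'≡) =
        subst₂ (RaisedBlock (k * d))
          (sym (trans (exponentsᵛ≡exponentsˡ v) (cong exponentsˡ v≡)))
          (sym (trans (exponentsᵛ≡exponentsˡ v') (cong exponentsˡ v'≡)))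
          (raised-exponentsˡ-++ˡ pre same-length (root-raises lc lc' mid≡))
        where
        same-length : length (c ∷ post) ≡ length (a ∷ c' ∷ post')
        same-length = +-cancelˡ-≡ (length pre) _ _ (begin
          length pre + length (c ∷ post)      ≡⟨ length-++ pre ⟨
          length (pre ++ c ∷ post)            ≡⟨ cong length v≡ ⟨
          length (toList v)                   ≡⟨ trans (Vec.length-toList v) (sym (Vec.length-toList v')) ⟩
          length (toList v')                  ≡⟨ cong length v'≡ ⟩
          length (pre ++ a ∷ c' ∷ post')      ≡⟨ length-++ pre ⟩
          length pre + length (a ∷ c' ∷ post') ∎)
          where open ≡-Reasoning
      step-raises (inside v i s) = raisedᵛ v i (step-raises s)
        where
        raisedᵛ : ∀ {j} (v : Vec (Tree (suc d)) j) i {t'} → RaisedBlock (k * d) (exponents (lookup v i)) (exponents t') →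
                  RaisedBlock (k * d) (exponentsᵛ v) (exponentsᵛ (v [ i ]≔ t'))
        raisedᵛ {suc j} (t ∷ ts) zero    r = raised-++ʳ (exponentsᵛ ts) (raised-map-+ j r)
        raisedᵛ {suc j} (t ∷ ts) (suc i) r = raised-++ˡ (map (j +_) (exponents t)) (raisedᵛ ts i r)

    -- The entry of spines t at leaf i is the number of nodes of t whose leftmost leaf is i.
    mutual
      spine : Tree (suc d) → ℕ
      spine leaf            = 0
      spine (node (t ∷ ts)) = suc (spine t)

      innerSpines : Tree (suc d) → List ℕ
      innerSpines leaf            = []
      innerSpines (node (t ∷ ts)) = innerSpines t ++ spinesᵛ ts

      spinesᵛ : ∀ {j} → Vec (Tree (suc d)) j → List ℕ
      spinesᵛ []       = []
      spinesᵛ (t ∷ ts) = spine t ∷ innerSpines t ++ spinesᵛ ts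

    spines : Tree (suc d) → List ℕ
    spines t = spine t ∷ innerSpines t

    mutual
      length-spines : ∀ t → length (spines t) ≡ leaves t
      length-spines leaf            = refl
      length-spines (node (t ∷ ts)) = length-spinesᵛ (t ∷ ts)

      length-spinesᵛ : ∀ {j} (ts : Vec (Tree (suc d)) j) → length (spinesᵛ ts) ≡ leavesV ts
      length-spinesᵛ []       = refl
      length-spinesᵛ (t ∷ ts) = trans (length-++ (spines t)) (cong₂ _+_ (length-spines t) (length-spinesᵛ ts))

    length-suffixSums-spines : ∀ t → length (suffixSums (spines t)) ≡ leaves t
    length-suffixSums-spines t = trans (length-suffixSums (spines t)) (length-spines t)

    mutual
      leaves-spines : ∀ t → leaves t ≡ suc (d * sum (spines t))
      leaves-spines leaf            = cong suc (sym (*-zeroʳ d))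
      leaves-spines (node (t ∷ ts)) = trans (leaves-spinesᵛ (t ∷ ts)) (cong suc (sym (*-suc d _)))

      leaves-spinesᵛ : ∀ {j} (ts : Vec (Tree (suc d)) j) → leavesV ts ≡ j + d * sum (spinesᵛ ts)
      leaves-spinesᵛ []                 = sym (*-zeroʳ d)
      leaves-spinesᵛ {suc j} (t ∷ ts) = begin
        leaves t + leavesV ts                                    ≡⟨ cong₂ _+_ (leaves-spines t) (leaves-spinesᵛ ts) ⟩
        suc (d * sum (spines t)) + (j + d * sum (spinesᵛ ts))    ≡⟨ regroup d j (sum (spines t)) (sum (spinesᵛ ts)) ⟩
        suc j + d * (sum (spines t) + sum (spinesᵛ ts))          ≡⟨ cong (λ s → suc j + d * s) (sum-++ (spines t) (spinesᵛ ts)) ⟨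
        suc j + d * sum (spines t ++ spinesᵛ ts)                 ∎
        where
        open ≡-Reasoning
        regroup : ∀ d j s s' → suc (d * s) + (j + d * s') ≡ suc j + d * (s + s')
        regroup = solve-∀

    mutual
      exponents-spines : ∀ t → zipWith _+_ (exponents t) (map (d *_) (suffixSums (spines t))) ≡ downFrom (leaves t)
      exponents-spines leaf            = cong (_∷ []) (*-zeroʳ d)
      exponents-spines (node (t ∷ ts)) = exponents-spinesᵛ (t ∷ ts)

      exponents-spinesᵛ : ∀ {j} (ts : Vec (Tree (suc d)) j) →
        zipWith _+_ (exponentsᵛ ts) (map (d *_) (suffixSums (spinesᵛ ts))) ≡ downFrom (leavesV ts)
      exponents-spinesᵛ []               = refl
      exponents-spinesᵛ {suc j} (t ∷ ts) = begin
        zipWith _+_ (map (j +_) E ++ Eᵛ) (map (d *_) (suffixSums (spines t ++ spinesᵛ ts)))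
          ≡⟨ cong (λ s → zipWith _+_ (map (j +_) E ++ Eᵛ) (map (d *_) s)) (suffixSums-++ (spines t) (spinesᵛ ts)) ⟩
        zipWith _+_ (map (j +_) E ++ Eᵛ) (map (d *_) (map (_+ H) S ++ Sᵛ))
          ≡⟨ cong (zipWith _+_ (map (j +_) E ++ Eᵛ)) (trans (map-++ (d *_) (map (_+ H) S) Sᵛ) (cong (_++ map (d *_) Sᵛ) scale)) ⟩
        zipWith _+_ (map (j +_) E ++ Eᵛ) (map (d * H +_) (map (d *_) S) ++ map (d *_) Sᵛ)
          ≡⟨ zipWith-++ _+_ (map (j +_) E) Eᵛ (map (d * H +_) (map (d *_) S)) (map (d *_) Sᵛ) same-length ⟩
        zipWith _+_ (map (j +_) E) (map (d * H +_) (map (d *_) S)) ++ zipWith _+_ Eᵛ (map (d *_) Sᵛ)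
          ≡⟨ cong₂ _++_ (zipWith-+-map-+ j (d * H) E (map (d *_) S)) (exponents-spinesᵛ ts) ⟩
        map (j + d * H +_) (zipWith _+_ E (map (d *_) S)) ++ downFrom (leavesV ts)
          ≡⟨ cong₂ (λ a e → map (a +_) e ++ downFrom (leavesV ts)) (leaves-spinesᵛ ts) (sym (exponents-spines t)) ⟨
        map (leavesV ts +_) (downFrom (leaves t)) ++ downFrom (leavesV ts)
          ≡⟨ downFrom-+ (leaves t) (leavesV ts) ⟨
        downFrom (leaves t + leavesV ts) ∎
        where
        open ≡-Reasoning
        E  = exponents t
        Eᵛ = exponentsᵛ ts
        S  = suffixSums (spines t)
        Sᵛ = suffixSums (spinesᵛ ts)
        H  = sum (spinesᵛ ts)
        scale : map (d *_) (map (_+ H) S) ≡ map (d * H +_) (map (d *_) S)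
        scale = trans (sym (map-∘ S)) (trans (map-cong (λ s → trans (*-distribˡ-+ d s H) (+-comm (d * s) (d * H))) S) (map-∘ S))
        same-length : length (map (j +_) E) ≡ length (map (d * H +_) (map (d *_) S))
        same-length = begin
          length (map (j +_) E)                     ≡⟨ length-map (j +_) E ⟩
          length E                                  ≡⟨ length-exponents t ⟩
          leaves t                                  ≡⟨ length-suffixSums-spines t ⟨
          length S                                  ≡⟨ length-map (d *_) S ⟨
          length (map (d *_) S)                     ≡⟨ length-map (d * H +_) (map (d *_) S) ⟨
          length (map (d * H +_) (map (d *_) S))    ∎

    weight : Tree (suc d) → ℕ
    weight t = sum (suffixSums (spines t))

    sum-exponents+weight : ∀ t → sum (exponents t) + d * weight t ≡ sum (downFrom (leaves t))
    sum-exponents+weight t = begin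
      sum (exponents t) + d * weight t                                     ≡⟨ cong (sum (exponents t) +_) (sum-map-* d S) ⟨
      sum (exponents t) + sum (map (d *_) S)                               ≡⟨ sum-zipWith-+ (exponents t) (map (d *_) S) same-length ⟨
      sum (zipWith _+_ (exponents t) (map (d *_) S))                       ≡⟨ cong sum (exponents-spines t) ⟩
      sum (downFrom (leaves t))                                            ∎
      where
      open ≡-Reasoning
      S = suffixSums (spines t)
      same-length : length (exponents t) ≡ length (map (d *_) S)
      same-length = trans (length-exponents t) (sym (trans (length-map (d *_) S) (length-suffixSums-spines t)))

    spinesᵛ-∷-++ : ∀ {j} t (ts : Vec (Tree (suc d)) j) r → spinesᵛ (t ∷ ts) ++ r ≡ spines t ++ (spinesᵛ ts ++ r)
    spinesᵛ-∷-++ t ts r = cong (spine t ∷_) (++-assoc (innerSpines t) (spinesᵛ ts) r)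

    mutual
      spines-++-injective : ∀ t t' {r r'} → spines t ++ r ≡ spines t' ++ r' → t ≡ t' × r ≡ r'
      spines-++-injective leaf            leaf              eq = refl , ∷-injectiveʳ eq
      spines-++-injective leaf            (node (_ ∷ _))    ()
      spines-++-injective (node (_ ∷ _))  leaf              ()
      spines-++-injective (node (t ∷ ts)) (node (t' ∷ ts')) eq
        with spinesᵛ-++-injective (t ∷ ts) (t' ∷ ts') (cong₂ _∷_ (suc-injective (∷-injectiveˡ eq)) (∷-injectiveʳ eq))
      ... | refl , r≡r' = refl , r≡r'

      spinesᵛ-++-injective : ∀ {j} (ts ts' : Vec (Tree (suc d)) j) {r r'} →
                             spinesᵛ ts ++ r ≡ spinesᵛ ts' ++ r' → ts ≡ ts' × r ≡ r'
      spinesᵛ-++-injective []       []         eq = refl , eq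
      spinesᵛ-++-injective (t ∷ ts) (t' ∷ ts') {r} {r'} eq
        with spines-++-injective t t' (trans (sym (spinesᵛ-∷-++ t ts r)) (trans eq (spinesᵛ-∷-++ t' ts' r')))
      ... | refl , eq′ with spinesᵛ-++-injective ts ts' eq′
      ...   | refl , r≡r' = refl , r≡r'

    spines-injective : ∀ {t t'} → spines t ≡ spines t' → t ≡ t'
    spines-injective {t} {t'} eq = proj₁ (spines-++-injective t t' (cong (_++ []) eq))

    -- Undoes a k-associative step (k = g+1) between a and its right sibling c'.
    leftComb-regroup : ∀ g a c' → suc g ≤ spine c' →
      ∃[ c ] ∃[ z ] ∃[ mid ] ∃[ mid' ]
        LeftComb (suc g) c mid × LeftComb (suc g) c' mid' × (a ∷ mid' ≡ mid ++ z ∷ [])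
    leftComb-regroup zero a (node v) _ =
      node (init (a ∷ v)) , last (a ∷ v) , toList (init (a ∷ v)) , toList v ,
      comb-one _ , comb-one v , toList-init-last (a ∷ v)
    leftComb-regroup (suc g) a (node (t ∷ ys)) (s≤s g<spine)
      with leftComb-regroup g a t g<spine
    ... | c , z , mid , mid' , lc , lc' , eq =
      node (c ∷ init (z ∷ ys)) , last (z ∷ ys) , mid ++ toList (init (z ∷ ys)) , mid' ++ toList ys ,
      comb-suc lc _ _ refl , comb-suc lc' _ _ refl , (begin
        a ∷ mid' ++ toList ys                                              ≡⟨ cong (_++ toList ys) eq ⟩
        (mid ++ z ∷ []) ++ toList ys                                       ≡⟨ ++-assoc mid (z ∷ []) (toList ys) ⟩
        mid ++ toList (z ∷ ys)                                             ≡⟨ cong (mid ++_) (toList-init-last (z ∷ ys)) ⟩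
        mid ++ toList (init (z ∷ ys)) ++ last (z ∷ ys) ∷ []         ≡⟨ ++-assoc mid _ _ ⟨
        (mid ++ toList (init (z ∷ ys))) ++ last (z ∷ ys) ∷ []       ∎)
      where open ≡-Reasoning

  module _ {d : ℕ} {{_ : NonZero d}} (k₁ : ℕ) where

    private
      k : ℕ
      k = suc k₁

      T : Set
      T = Tree (suc d)

      instance
        k*d≢0 : NonZero (k * d)
        k*d≢0 = m*n≢0 k d

    residues : T → List ℕ
    residues t = map (_% (k * d)) (exponents t)

    residues-leaves : ∀ {t t'} → residues t ≡ residues t' → leaves t ≡ leaves t'
    residues-leaves {t} {t'} eq = begin
      leaves t                   ≡⟨ length-exponents t ⟨
      length (exponents t)       ≡⟨ length-map _ (exponents t) ⟨
      length (residues t)        ≡⟨ cong length eq ⟩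
      length (residues t')       ≡⟨ length-map _ (exponents t') ⟩
      length (exponents t')      ≡⟨ length-exponents t' ⟩
      leaves t'                  ∎
      where open ≡-Reasoning

    step-residues : ∀ {l r} → KStep (suc d) k l r → residues l ≡ residues r
    step-residues s = raised-residues (step-raises s)

    equivalent-residues : ∀ {p p'} → KEquivalent k p p' → residues p ≡ residues p'
    equivalent-residues = EqClosure.gfold isEquivalence residues step-residues

    step-weight : ∀ {l r} → KStep (suc d) k l r → weight l < weight r
    step-weight {l} {r} s = *-cancelˡ-< d (weight l) (weight r) (+-cancelˡ-< (sum (exponents r)) _ _ (begin-strict
      sum (exponents r) + d * weight l  <⟨ +-monoˡ-< (d * weight l) (raised-sum (step-raises s)) ⟩
      sum (exponents l) + d * weight l  ≡⟨ sum-exponents+weight l ⟩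
      sum (downFrom (leaves l))         ≡⟨ cong (λ n → sum (downFrom n)) (residues-leaves {l} {r} (step-residues s)) ⟩
      sum (downFrom (leaves r))         ≡⟨ sum-exponents+weight r ⟨
      sum (exponents r) + d * weight r  ∎))
      where open ≤-Reasoning

    Reduced : T → Set
    Reduced t = All (_< k) (innerSpines t)

    -- The data of a k-associative step at the root, for child vectors of any length so that a
    -- redex can be found by recursion on the children.
    record RootRewrite {j} (w' w : Vec T j) : Set where
      field
        pre mid post mid' post' : List T
        a c c'                  : T
        comb                    : LeftComb k c mid
        comb'                   : LeftComb k c' mid'
        arguments               : mid ++ post ≡ a ∷ (mid' ++ post')
        lhs                     : toList w' ≡ pre ++ c ∷ post
        rhs                     : toList w ≡ pre ++ a ∷ c' ∷ post'

    rootRewrite-∷ : ∀ {j} x {w' w : Vec T j} → RootRewrite w' w → RootRewrite (x ∷ w') (x ∷ w)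
    rootRewrite-∷ x rw = record
      { RootRewrite rw hiding (pre; lhs; rhs)
      ; pre = x ∷ pre ; lhs = cong (x ∷_) lhs ; rhs = cong (x ∷_) rhs }
      where open RootRewrite rw using (pre; lhs; rhs)

    rootRewrite-step : ∀ {w' w : Vec T (suc d)} → RootRewrite w' w → KStep (suc d) k (node w') (node w)
    rootRewrite-step {w' = w'} {w} rw = k-assoc pre mid post mid' post' a c c' w' w in-range comb comb' arguments lhs rhs
      where
      open RootRewrite rw
      in-range : suc (length pre) < suc d
      in-range = begin-strict
        suc (length pre)                 <⟨ s≤s (s≤s (m≤m+n (length pre) (length post'))) ⟩
        suc (suc (length pre + length post')) ≡⟨ cong suc (+-suc (length pre) (length post')) ⟨
        suc (length pre + suc (length post')) ≡⟨ +-suc (length pre) (suc (length post')) ⟨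
        length pre + length (a ∷ c' ∷ post') ≡⟨ length-++ pre ⟨
        length (pre ++ a ∷ c' ∷ post')   ≡⟨ cong length rhs ⟨
        length (toList w)                ≡⟨ Vec.length-toList w ⟩
        suc d                            ∎
        where open ≤-Reasoning

    spine-rootRewrite : ∀ {j} a c' (xs : Vec T j) → k ≤ spine c' → ∃[ w' ] RootRewrite w' (a ∷ c' ∷ xs)
    spine-rootRewrite a c' xs k≤spine with leftComb-regroup k₁ a c' k≤spine
    ... | c , z , mid , mid' , lc , lc' , eq = c ∷ z ∷ xs , record
      { pre = [] ; mid = mid ; post = z ∷ toList xs ; mid' = mid' ; post' = toList xs
      ; a = a ; c = c ; c' = c' ; comb = lc ; comb' = lc'
      ; arguments = sym (trans (cong (_++ toList xs) eq) (++-assoc mid (z ∷ []) (toList xs)))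
      ; lhs = refl ; rhs = refl }

    scanRoot : ∀ {j} x (ts : Vec T j) → VecAll.All (λ t → spine t < k) ts ⊎ ∃[ w' ] RootRewrite w' (x ∷ ts)
    scanRoot x []       = inj₁ VecAll.[]
    scanRoot x (t ∷ ts) with k ≤? spine t
    ... | yes k≤spine = inj₂ (spine-rootRewrite x t ts k≤spine)
    ... | no  k≰spine with scanRoot t ts
    ...   | inj₁ small        = inj₁ (≰⇒> k≰spine VecAll.∷ small)
    ...   | inj₂ (w' , rw)    = inj₂ (x ∷ w' , rootRewrite-∷ x rw)

    inside-lookup : ∀ (v : Vec T (suc d)) i {y} → KStep (suc d) k y (lookup v i) → KStep (suc d) k (node (v [ i ]≔ y)) (node v)
    inside-lookup v i {y} s = subst (λ w → KStep (suc d) k (node (v [ i ]≔ y)) (node w))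
      (trans (Vec.[]≔-idempotent v i) (Vec.[]≔-lookup v i))
      (inside (v [ i ]≔ y) i (subst (λ z → KStep (suc d) k z (lookup v i)) (sym (Vec.lookup∘update i v y)) s))

    reduced-spinesᵛ : ∀ {j} {ts : Vec T j} → VecAll.All Reduced ts → VecAll.All (λ t → spine t < k) ts → All (_< k) (spinesᵛ ts)
    reduced-spinesᵛ VecAll.[]         VecAll.[]         = []
    reduced-spinesᵛ (r VecAll.∷ rs)   (s VecAll.∷ ss)   = s ∷ ++⁺ r (reduced-spinesᵛ rs ss)

    mutual
      reduced-or-step : (t : T) → Reduced t ⊎ ∃[ y ] KStep (suc d) k y t
      reduced-or-step leaf = inj₁ []
      reduced-or-step (node (t ∷ ts)) with reducedᵛ-or-step (t ∷ ts)
      ... | inj₂ (i , y , s) = inj₂ (_ , inside-lookup (t ∷ ts) i s)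
      ... | inj₁ (rt VecAll.∷ rts) with scanRoot t ts
      ...   | inj₁ small    = inj₁ (++⁺ rt (reduced-spinesᵛ rts small))
      ...   | inj₂ (w' , rw) = inj₂ (node w' , rootRewrite-step rw)

      reducedᵛ-or-step : ∀ {j} (ts : Vec T j) → VecAll.All Reduced ts ⊎ ∃[ i ] ∃[ y ] KStep (suc d) k y (lookup ts i)
      reducedᵛ-or-step []       = inj₁ VecAll.[]
      reducedᵛ-or-step (t ∷ ts) with reduced-or-step t
      ... | inj₂ (y , s) = inj₂ (zero , y , s)
      ... | inj₁ rt with reducedᵛ-or-step ts
      ...   | inj₁ rts         = inj₁ (rt VecAll.∷ rts)
      ...   | inj₂ (i , y , s) = inj₂ (suc i , y , s)

    normalForm : ∀ t → ∃[ u ] Reduced u × KEquivalent k t u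
    normalForm t = descend t (<-wellFounded (weight t))
      where
      descend : ∀ t → Acc _<_ (weight t) → ∃[ u ] Reduced u × KEquivalent k t u
      descend t (acc rec) with reduced-or-step t
      ... | inj₁ r       = t , r , ε
      ... | inj₂ (y , s) with descend y (rec (step-weight s))
      ...   | u , r , y~u = u , r , bwd s ◅ y~u

    suffixSums-residues : ∀ e e' s s' → length e ≡ length s → length e' ≡ length s' →
      zipWith _+_ e (map (d *_) s) ≡ zipWith _+_ e' (map (d *_) s') →
      map (_% (k * d)) e ≡ map (_% (k * d)) e' → map (_% k) s ≡ map (_% k) s'
    suffixSums-residues []      []        []      []        _ _ _  _  = refl
    suffixSums-residues (x ∷ e) (x' ∷ e') (y ∷ s) (y' ∷ s') l l' eq eq% =
      cong₂ _∷_ (%-*-cancelʳ y y' k d (subst₂ (λ a b → a % (k * d) ≡ b % (k * d)) (*-comm d y) (*-comm d y')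
                   (%-cancel-+ˡ x x' (d * y) (d * y') (∷-injectiveˡ eq%) (cong (_% (k * d)) (∷-injectiveˡ eq)))))
                (suffixSums-residues e e' s s' (suc-injective l) (suc-injective l') (∷-injectiveʳ eq) (∷-injectiveʳ eq%))

    small-suffixSums-injective : ∀ xs xs' → All (_< k) xs → All (_< k) xs' →
      map (_% k) (sum xs ∷ suffixSums xs) ≡ map (_% k) (sum xs' ∷ suffixSums xs') → xs ≡ xs'
    small-suffixSums-injective []       []         _ _ _ = refl
    small-suffixSums-injective (x ∷ xs) (x' ∷ xs') (x<k ∷ xs<k) (x'<k ∷ xs'<k) eq
      with small-suffixSums-injective xs xs' xs<k xs'<k (∷-injectiveʳ eq)
    ... | refl = cong (_∷ xs) (begin
      x      ≡⟨ m<n⇒m%n≡m x<k ⟨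
      x % k  ≡⟨ %-cancel-+ˡ (sum xs) (sum xs) x x' refl heads ⟩
      x' % k ≡⟨ m<n⇒m%n≡m x'<k ⟩
      x'     ∎)
      where
      open ≡-Reasoning
      heads : (sum xs + x) % k ≡ (sum xs + x') % k
      heads = subst₂ (λ a b → a % k ≡ b % k) (+-comm x (sum xs)) (+-comm x' (sum xs)) (∷-injectiveˡ eq)

    reduced-unique : ∀ {u u'} → Reduced u → Reduced u' → residues u ≡ residues u' → u ≡ u'
    reduced-unique {u} {u'} ru ru' eq = spines-injective (cong₂ _∷_ spine≡ inner≡)
      where
      open ≡-Reasoning
      same-leaves : leaves u ≡ leaves u'
      same-leaves = residues-leaves {u} {u'} eq
      inner≡ : innerSpines u ≡ innerSpines u'
      inner≡ = small-suffixSums-injective (innerSpines u) (innerSpines u') ru ru'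
        (suffixSums-residues (exponents u) (exponents u') (suffixSums (spines u)) (suffixSums (spines u'))
          (trans (length-exponents u) (sym (length-suffixSums-spines u)))
          (trans (length-exponents u') (sym (length-suffixSums-spines u')))
          (trans (exponents-spines u) (trans (cong downFrom same-leaves) (sym (exponents-spines u'))))
          eq)
      spine≡ : spine u ≡ spine u'
      spine≡ = +-cancelʳ-≡ (sum (innerSpines u)) (spine u) (spine u') (*-cancelˡ-≡ _ _ d (suc-injective (begin
        suc (d * sum (spines u))                         ≡⟨ leaves-spines u ⟨
        leaves u                                         ≡⟨ same-leaves ⟩
        leaves u'                                        ≡⟨ leaves-spines u' ⟩
        suc (d * sum (spines u'))                        ≡⟨ cong (λ xs → suc (d * (spine u' + sum xs))) inner≡ ⟨
        suc (d * (spine u' + sum (innerSpines u)))       ∎)))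

    residues-equivalent : ∀ {p p'} → residues p ≡ residues p' → KEquivalent k p p'
    residues-equivalent {p} {p'} eq with normalForm p | normalForm p'
    ... | u , ru , p~u | u' , ru' , p'~u'
      with reduced-unique {u} {u'} ru ru' (trans (sym (equivalent-residues p~u)) (trans eq (equivalent-residues p'~u')))
    ... | refl = EqClosure.transitive _ p~u (EqClosure.symmetric _ p'~u')

    equivalent⇔residues : ∀ {p p'} → KEquivalent k p p' ⇔ residues p ≡ residues p'
    equivalent⇔residues = mk⇔ equivalent-residues residues-equivalent

module Evaluation where

  open import Data.Nat as ℕ using (ℕ; zero; suc; _∸_; _≤_; _<_; _≟_; z≤n; s≤s; NonZero)
  open import Data.Nat.Properties as ℕ using (∸-+-assoc; ≤-total; m∸n≡0⇒m≤n)
  open import Data.Nat.DivMod using (_%_; _/_; m≡m%n+[m/n]*n; m%n<n)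
  open import Data.Fin using (toℕ; fromℕ<)
  open import Data.Fin.Properties using (toℕ-fromℕ<)
  open import Data.Vec using (Vec; []; _∷_; lookup)
  import Data.Vec.Properties as Vec
  open import Data.List using (List; []; _∷_; _++_; length; map)
  open import Data.List.Properties using (length-map)
  open import Data.Product using (proj₁; proj₂)
  open import Data.Sum using ([_,_]′)
  open import Relation.Nullary using (¬_; yes; no; contradiction)
  open import Relation.Binary.PropositionalEquality as ≡ using (_≡_)
  open import Function.Bundles using (_⇔_; mk⇔)
  open import Algebra.Bundles using (CommutativeRing)
  open Combinatorics using (exponents; exponentsᵛ; length-exponents)

  module _ {c ℓ} (R : CommutativeRing c ℓ) (n : ℕ) where

    open CommutativeRing R
    open FreeAlg R n
    open import Algebra.Properties.Semiring.Exp semiring using (_^_; ^-homo-*)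
    open import Algebra.Properties.Group +-group using (∙-cancelˡ)
    open import Relation.Binary.Reasoning.Setoid setoid

    pow≡^ : ∀ x e → pow x e ≡ x ^ e
    pow≡^ x zero    = ≡.refl
    pow≡^ x (suc e) = ≡.cong (x *_) (pow≡^ x e)

    pow-+ : ∀ x a b → pow x (a ℕ.+ b) ≈ pow x a * pow x b
    pow-+ x a b rewrite pow≡^ x (a ℕ.+ b) | pow≡^ x a | pow≡^ x b = ^-homo-* x a b

    u-hit : ∀ i j → toℕ j ≡ i → u i (j ∷ []) ≈ 1#
    u-hit i j eq with toℕ j ≟ i
    ... | yes _   = refl
    ... | no  j≢i = contradiction eq j≢i

    u-miss : ∀ i j → ¬ toℕ j ≡ i → u i (j ∷ []) ≈ 0#
    u-miss i j j≢i with toℕ j ≟ i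
    ... | yes eq = contradiction eq j≢i
    ... | no  _  = refl

    module _ (ω : Carrier) where

      linComb : ℕ → List ℕ → A
      linComb i []       w = 0#
      linComb i (e ∷ es) w = pow ω e * u i w + linComb (suc i) es w

      linComb-++ : ∀ i es es' w → linComb i (es ++ es') w ≈ linComb i es w + linComb (i ℕ.+ length es) es' w
      linComb-++ i []       es' w = trans (reflexive (≡.cong (λ j → linComb j es' w) (≡.sym (ℕ.+-identityʳ i)))) (sym (+-identityˡ _))
      linComb-++ i (e ∷ es) es' w = begin
        pow ω e * u i w + linComb (suc i) (es ++ es') w
          ≈⟨ +-congˡ (linComb-++ (suc i) es es' w) ⟩
        pow ω e * u i w + (linComb (suc i) es w + linComb (suc i ℕ.+ length es) es' w)
          ≈⟨ +-assoc _ _ _ ⟨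
        pow ω e * u i w + linComb (suc i) es w + linComb (suc i ℕ.+ length es) es' w
          ≡⟨ ≡.cong (λ j → pow ω e * u i w + linComb (suc i) es w + linComb j es' w) (ℕ.+-suc i (length es)) ⟨
        pow ω e * u i w + linComb (suc i) es w + linComb (i ℕ.+ suc (length es)) es' w ∎

      linComb-map-+ : ∀ a i es w → linComb i (map (a ℕ.+_) es) w ≈ pow ω a * linComb i es w
      linComb-map-+ a i []       w = sym (zeroʳ _)
      linComb-map-+ a i (e ∷ es) w = begin
        pow ω (a ℕ.+ e) * u i w + linComb (suc i) (map (a ℕ.+_) es) w
          ≈⟨ +-cong (*-congʳ (pow-+ ω a e)) (linComb-map-+ a (suc i) es w) ⟩
        pow ω a * pow ω e * u i w + pow ω a * linComb (suc i) es w
          ≈⟨ +-congʳ (*-assoc _ _ _) ⟩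
        pow ω a * (pow ω e * u i w) + pow ω a * linComb (suc i) es w
          ≈⟨ distribˡ _ _ _ ⟨
        pow ω a * (pow ω e * u i w + linComb (suc i) es w) ∎

      circ-∷ : ∀ {j} a (as : Vec A j) w → circ ω (suc j) (a ∷ as) w ≈ pow ω j * a w + circ ω j as w
      circ-∷ {j} a as w = +-congˡ (reflexive (≡.cong sumV (Vec.tabulate-cong λ i →
        ≡.cong (λ e → pow ω e * lookup as i w) (≡.sym (∸-+-assoc j 1 (toℕ i))))))

      module _ {m : ℕ} where

        open Evaluate (circ ω m) u

        mutual
          evalAt-linComb : ∀ t i w → evalAt t i w ≈ linComb i (exponents t) w
          evalAt-linComb leaf     i w = sym (trans (+-identityʳ _) (*-identityˡ _))
          evalAt-linComb (node v) i w = evalsAt-linComb v i w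

          evalsAt-linComb : ∀ {j} (ts : Vec (Tree m) j) i w → circ ω j (evalsAt ts i) w ≈ linComb i (exponentsᵛ ts) w
          evalsAt-linComb []               i w = refl
          evalsAt-linComb {suc j} (t ∷ ts) i w = begin
            circ ω (suc j) (evalAt t i ∷ evalsAt ts (i ℕ.+ leaves t)) w
              ≈⟨ circ-∷ (evalAt t i) (evalsAt ts (i ℕ.+ leaves t)) w ⟩
            pow ω j * evalAt t i w + circ ω j (evalsAt ts (i ℕ.+ leaves t)) w
              ≈⟨ +-cong (*-congˡ (evalAt-linComb t i w)) (evalsAt-linComb ts (i ℕ.+ leaves t) w) ⟩
            pow ω j * linComb i (exponents t) w + linComb (i ℕ.+ leaves t) (exponentsᵛ ts) w
              ≈⟨ +-congʳ (linComb-map-+ j i (exponents t) w) ⟨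
            linComb i (map (j ℕ.+_) (exponents t)) w + linComb (i ℕ.+ leaves t) (exponentsᵛ ts) w
              ≡⟨ ≡.cong (λ l → linComb i (map (j ℕ.+_) (exponents t)) w + linComb (i ℕ.+ l) (exponentsᵛ ts) w)
                   (≡.trans (length-map (j ℕ.+_) (exponents t)) (length-exponents t)) ⟨
            linComb i (map (j ℕ.+_) (exponents t)) w + linComb (i ℕ.+ length (map (j ℕ.+_) (exponents t))) (exponentsᵛ ts) w
              ≈⟨ linComb-++ i (map (j ℕ.+_) (exponents t)) (exponentsᵛ ts) w ⟨
            linComb i (map (j ℕ.+_) (exponents t) ++ exponentsᵛ ts) w ∎

      linComb-vanishes : ∀ i es j → toℕ j < i → linComb i es (j ∷ []) ≈ 0#
      linComb-vanishes i []       j j<i = refl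
      linComb-vanishes i (e ∷ es) j j<i = begin
        pow ω e * u i (j ∷ []) + linComb (suc i) es (j ∷ [])
          ≈⟨ +-cong (*-congˡ (u-miss i j (λ j≡i → ℕ.<-irrefl j≡i j<i))) (linComb-vanishes (suc i) es j (ℕ.m<n⇒m<1+n j<i)) ⟩
        pow ω e * 0# + 0#   ≈⟨ +-identityʳ _ ⟩
        pow ω e * 0#        ≈⟨ zeroʳ _ ⟩
        0#                  ∎

      linComb-coefficient : ∀ i e es j → toℕ j ≡ i → linComb i (e ∷ es) (j ∷ []) ≈ pow ω e
      linComb-coefficient i e es j j≡i = begin
        pow ω e * u i (j ∷ []) + linComb (suc i) es (j ∷ [])
          ≈⟨ +-cong (*-congˡ (u-hit i j j≡i)) (linComb-vanishes (suc i) es j (ℕ.≤-reflexive (≡.cong suc j≡i))) ⟩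
        pow ω e * 1# + 0#   ≈⟨ +-identityʳ _ ⟩
        pow ω e * 1#        ≈⟨ *-identityʳ _ ⟩
        pow ω e             ∎

      module _ {N : ℕ} .{{_ : NonZero N}} (ω-order : HasOrder ω N) where

        pow-*N : ∀ q → pow ω (q ℕ.* N) ≈ 1#
        pow-*N zero    = refl
        pow-*N (suc q) = begin
          pow ω (N ℕ.+ q ℕ.* N)      ≈⟨ pow-+ ω N (q ℕ.* N) ⟩
          pow ω N * pow ω (q ℕ.* N)  ≈⟨ *-cong (proj₁ ω-order) (pow-*N q) ⟩
          1# * 1#                    ≈⟨ *-identityˡ 1# ⟩
          1#                         ∎

        pow-% : ∀ a → pow ω a ≈ pow ω (a % N)
        pow-% a = begin
          pow ω a                                ≡⟨ ≡.cong (pow ω) (m≡m%n+[m/n]*n a N) ⟩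
          pow ω (a % N ℕ.+ a / N ℕ.* N)          ≈⟨ pow-+ ω (a % N) (a / N ℕ.* N) ⟩
          pow ω (a % N) * pow ω (a / N ℕ.* N)    ≈⟨ *-congˡ (pow-*N (a / N)) ⟩
          pow ω (a % N) * 1#                     ≈⟨ *-identityʳ _ ⟩
          pow ω (a % N)                          ∎

        pow≈1 : ∀ j → j < N → pow ω j ≈ 1# → j ≡ 0
        pow≈1 zero    _   _     = ≡.refl
        pow≈1 (suc j) j<N pow≈1# = contradiction pow≈1# (proj₂ ω-order (suc j) (s≤s z≤n) j<N)

        pow-injective-≤ : ∀ {r s} → r ≤ s → s < N → pow ω r ≈ pow ω s → r ≡ s
        pow-injective-≤ {r} {s} r≤s s<N pow≈ =
          ℕ.≤-antisym r≤s (m∸n≡0⇒m≤n (pow≈1 (s ∸ r) (ℕ.≤-<-trans (ℕ.m∸n≤m s r) s<N) (begin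
            pow ω (s ∸ r)                       ≈⟨ *-identityˡ _ ⟨
            1# * pow ω (s ∸ r)                  ≈⟨ *-congʳ (proj₁ ω-order) ⟨
            pow ω N * pow ω (s ∸ r)             ≈⟨ pow-+ ω N (s ∸ r) ⟨
            pow ω (N ℕ.+ (s ∸ r))               ≡⟨ ≡.cong (pow ω) exponent ⟩
            pow ω (N ∸ r ℕ.+ s)                 ≈⟨ pow-+ ω (N ∸ r) s ⟩
            pow ω (N ∸ r) * pow ω s             ≈⟨ *-congˡ pow≈ ⟨
            pow ω (N ∸ r) * pow ω r             ≈⟨ pow-+ ω (N ∸ r) r ⟨
            pow ω (N ∸ r ℕ.+ r)                 ≡⟨ ≡.cong (pow ω) (ℕ.m∸n+n≡m r≤N) ⟩
            pow ω N                             ≈⟨ proj₁ ω-order ⟩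
            1#                                  ∎)))
          where
          r≤N : r ≤ N
          r≤N = ℕ.≤-trans r≤s (ℕ.<⇒≤ s<N)
          exponent : N ℕ.+ (s ∸ r) ≡ N ∸ r ℕ.+ s
          exponent = ≡.trans (≡.cong (ℕ._+ (s ∸ r)) (≡.sym (ℕ.m∸n+n≡m r≤N)))
                     (≡.trans (ℕ.+-assoc (N ∸ r) r (s ∸ r)) (≡.cong (N ∸ r ℕ.+_) (ℕ.m+[n∸m]≡n r≤s)))

        pow-injective-% : ∀ a b → pow ω a ≈ pow ω b → a % N ≡ b % N
        pow-injective-% a b pow≈ =
          [ (λ a%N≤b%N → pow-injective-≤ a%N≤b%N (m%n<n b N) pow%≈)
          , (λ b%N≤a%N → ≡.sym (pow-injective-≤ b%N≤a%N (m%n<n a N) (sym pow%≈))) ]′ (≤-total (a % N) (b % N))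
          where
          pow%≈ : pow ω (a % N) ≈ pow ω (b % N)
          pow%≈ = trans (sym (pow-% a)) (trans pow≈ (pow-% b))

        linComb-residues : ∀ i es w → linComb i es w ≈ linComb i (map (_% N) es) w
        linComb-residues i []       w = refl
        linComb-residues i (e ∷ es) w = +-cong (*-congʳ (pow-% e)) (linComb-residues (suc i) es w)

        linComb-injective : ∀ i es es' → length es ≡ length es' → i ℕ.+ length es ≤ n →
          (∀ w → linComb i es w ≈ linComb i es' w) → map (_% N) es ≡ map (_% N) es'
        linComb-injective i []       []         _ _ _ = ≡.refl
        linComb-injective i (e ∷ es) (e' ∷ es') |es|≡ in-range same =
          ≡.cong₂ _∷_ (pow-injective-% e e' pow≈)
            (linComb-injective (suc i) es es' (ℕ.suc-injective |es|≡) (≡.subst (_≤ n) (ℕ.+-suc i (length es)) in-range)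
              λ w → ∙-cancelˡ (pow ω e * u i w) _ _ (trans (same w) (+-congʳ (*-congʳ (sym pow≈)))))
          where
          i<n : i < n
          i<n = ℕ.≤-trans (s≤s (ℕ.m≤m+n i (length es))) (≡.subst (_≤ n) (ℕ.+-suc i (length es)) in-range)
          j = fromℕ< i<n
          pow≈ : pow ω e ≈ pow ω e'
          pow≈ = begin
            pow ω e                         ≈⟨ linComb-coefficient i e es j (toℕ-fromℕ< i<n) ⟨
            linComb i (e ∷ es) (j ∷ [])     ≈⟨ same (j ∷ []) ⟩
            linComb i (e' ∷ es') (j ∷ [])   ≈⟨ linComb-coefficient i e' es' j (toℕ-fromℕ< i<n) ⟩
            pow ω e'                        ∎

        evalCirc⇔residues : ∀ {m} (p p' : Tree m) → leaves p ≡ n → leaves p' ≡ n →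
          evalCirc ω m p ≈A evalCirc ω m p' ⇔ map (_% N) (exponents p) ≡ map (_% N) (exponents p')
        evalCirc⇔residues p p' p-leaves p'-leaves = mk⇔
          (λ same → linComb-injective 0 (exponents p) (exponents p')
            (≡.trans (length-exponents p) (≡.trans p-leaves (≡.sym (≡.trans (length-exponents p') p'-leaves))))
            (ℕ.≤-reflexive (≡.trans (length-exponents p) p-leaves))
            λ w → trans (sym (evalAt-linComb p 0 w)) (trans (same w) (evalAt-linComb p' 0 w)))
          λ residues≡ w → begin
            evalCirc ω _ p w                                 ≈⟨ evalAt-linComb p 0 w ⟩
            linComb 0 (exponents p) w                         ≈⟨ linComb-residues 0 (exponents p) w ⟩
            linComb 0 (map (_% N) (exponents p)) w            ≡⟨ ≡.cong (λ es → linComb 0 es w) residues≡ ⟩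
            linComb 0 (map (_% N) (exponents p')) w           ≈⟨ linComb-residues 0 (exponents p') w ⟨
            linComb 0 (exponents p') w                        ≈⟨ evalAt-linComb p' 0 w ⟨
            evalCirc ω _ p' w                                 ∎

open Combinatorics using (equivalent⇔residues)
open Evaluation using (evalCirc⇔residues)
open import Data.Nat using (ℕ; suc; z≤n; s≤s; _≤_; _+_; _*_; _∸_)
open import Relation.Binary.PropositionalEquality using (_≡_)
open import Function.Bundles using (_⇔_)
open import Function.Properties.Equivalence using () renaming (trans to ⇔-trans; sym to ⇔-sym)
open import Algebra.Bundles using (CommutativeRing)

theorem1p1 : ∀ {c ℓ} (R : CommutativeRing c ℓ) (m k g n : ℕ) →
    2 ≤ m → 1 ≤ k → 1 ≤ g → n ≡ m + g * (m ∸ 1) →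
    (ω : CommutativeRing.Carrier R) → FreeAlg.HasOrder R n ω (k * (m ∸ 1)) →
    (p p' : Tree m) → leaves p ≡ n → leaves p' ≡ n →
    (KEquivalent k p p' ⇔ FreeAlg._≈A_ R n (FreeAlg.evalCirc R n ω m p) (FreeAlg.evalCirc R n ω m p'))
theorem1p1 R (suc (suc d₁)) (suc k₁) _ n (s≤s (s≤s z≤n)) (s≤s z≤n) _ _ ω ω-order p p' p-leaves p'-leaves =
  ⇔-trans (equivalent⇔residues k₁) (⇔-sym (evalCirc⇔residues R n ω ω-order p p' p-leaves p'-leaves))
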